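{- Let $\tau$ be a preorder on a finite set $E$. The number of interior lattice points of $2\mathcal{Q}_\tau$ is equal to the number of lattice points of $\mathcal{Q}_\tau$ not in the upper boundary $\hat{\partial}(\mathcal{Q}_\tau)$.
   Context: A preorder on $E$ is a reflexive transitive relation $\le$. An order ideal of $\tau$ is a subset $\mathcal{I}\subseteq E$ such that $b\in\mathcal{I}$ and $a\le b$ imply $a\in\mathcal{I}$. The preorder polytope $\mathcal{Q}_\tau\subset\mathbb{R}^E$ is defined by $x_e\ge0$ ($e\in E$) and $\sum_{e\in\mathcal{I}}x_e\le|\mathcal{I}|$ for every order ideal $\mathcal{I}$ of $\tau$. The upper boundary $\hat{\partial}(\mathcal{Q}_\tau)$ is the set of points of $\mathcal{Q}_\tau$ satisfying at least one of the inequalities $\sum_{e\in\mathcal{I}}x_e\le|\mathcal{I}|$ (over order ideals $\mathcal{I}$) with equality. -}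

module Defs where

open import Data.Nat as ℕ using (ℕ; zero; suc)
open import Data.Integer as ℤ using (ℤ; +_)
open import Data.Rational as ℚ using (ℚ; 0ℚ)
open import Data.Bool using (Bool; true; false)
open import Data.Fin using (Fin)
open import Data.Fin.Subset using (Subset; _∈_; ∣_∣; Nonempty)
open import Data.Vec using (Vec; []; _∷_; lookup; map)
open import Data.Vec.Relation.Unary.Unique.Propositional using (Unique)
open import Data.Product using (Σ; _×_; ∃; ∃-syntax)
open import Relation.Binary.PropositionalEquality using (_≡_)
open import Relation.Binary using (Rel; Reflexive; Transitive; Decidable)
open import Level using (0ℓ)
open import Function.Bundles using (_⇔_)
import Data.List as List
open import Data.List.Relation.Unary.Unique.Propositional as LU using ()
import Data.List.Membership.Propositional as LM

-- A preorder on the finite ground set E = Fin n (decidable, as every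
-- relation on a finite set is classically).
record Preorder (n : ℕ) : Set₁ where
  field
    _≼_   : Rel (Fin n) 0ℓ
    refl  : Reflexive _≼_
    trans : Transitive _≼_
    dec   : Decidable _≼_

IsOrderIdeal : ∀ {n} → Preorder n → Subset n → Set
IsOrderIdeal τ I = ∀ a b → b ∈ I → Preorder._≼_ τ a b → a ∈ I

sumOver : ∀ {n} → Subset n → Vec ℚ n → ℚ
sumOver []          []       = 0ℚ
sumOver (true  ∷ I) (x ∷ xs) = x ℚ.+ sumOver I xs
sumOver (false ∷ I) (x ∷ xs) = sumOver I xs

ℕtoℚ : ℕ → ℚ
ℕtoℚ k = (+ k) ℚ./ 1

ℤtoℚ : ℤ → ℚ
ℤtoℚ z = z ℚ./ 1

InDilatedQ : ∀ {n} → Preorder n → ℕ → Vec ℚ n → Set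
InDilatedQ {n} τ k y =
  (∀ (e : Fin n) → 0ℚ ℚ.≤ lookup y e) ×
  (∀ (I : Subset n) → IsOrderIdeal τ I → sumOver I y ℚ.≤ ℕtoℚ (k ℕ.* ∣ I ∣))

embed : ∀ {n} → Vec ℤ n → Vec ℚ n
embed = map ℤtoℚ

-- Lattice point x lies in the interior of k·Q_τ: some box neighbourhood
-- of positive radius ε around x is contained in k·Q_τ (tested on
-- rational points; for a rational polytope and a rational point this
-- is equivalent to the topological interior in ℝ^E).
InInteriorDilatedQ : ∀ {n} → Preorder n → ℕ → Vec ℤ n → Set
InInteriorDilatedQ {n} τ k x =
  ∃[ ε ] (0ℚ ℚ.< ε) ×
    (∀ (y : Vec ℚ n) →
       (∀ (e : Fin n) → ℚ.∣ lookup y e ℚ.- lookup (embed x) e ∣ ℚ.≤ ε) →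
       InDilatedQ τ k y)

InUpperBoundary : ∀ {n} → Preorder n → Vec ℚ n → Set
InUpperBoundary {n} τ y =
  InDilatedQ τ 1 y ×
  ∃[ I ] (IsOrderIdeal τ I × Nonempty I × (sumOver I y ≡ ℕtoℚ ∣ I ∣))

Enumerates : ∀ {n} → (Vec ℤ n → Set) → List.List (Vec ℤ n) → Set
Enumerates P L = LU.Unique L × (∀ x → (x LM.∈ L) ⇔ P x)

SameCount : ∀ {n} → (Vec ℤ n → Set) → (Vec ℤ n → Set) → Set
SameCount P Q =
  ∃[ L₁ ] ∃[ L₂ ] (Enumerates P L₁ × Enumerates Q L₂ ×
                   (List.length L₁ ≡ List.length L₂))

{-# OPTIONS --safe #-}

-- For a lattice point x, the conditions defining the interior of 2Q_τ and
-- the complement of the upper boundary in Q_τ both become strict integer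
-- inequalities: x lies in the interior of 2Q_τ iff x_e ≥ 1 for all e and
-- Σ_I x < 2|I| for every nonempty order ideal I (a box of radius
-- 1/(|E|+1) around such a point stays inside 2Q_τ), and x ∈ Q_τ avoids the
-- upper boundary iff x_e ≥ 0 and Σ_I x < |I|.  Translation by the all-ones
-- vector maps the second set bijectively onto the first, and both sets are
-- finite since they lie in the box [0, |E|]^E.

module Submission where

open import Defs
open import Data.Nat using (ℕ)
open import Relation.Nullary using (¬_)
open import Data.Product using (_×_)

open import Data.Bool using (true; false)
open import Data.Empty using (⊥-elim)
open import Data.Fin using () renaming (zero to fzero; suc to fsuc)
open import Data.Fin.Properties using (all?)
open import Data.Fin.Subset using (Subset; _∈_; ∣_∣; Nonempty; ⊤)
open import Data.Fin.Subset.Properties using (_∈?_; nonempty?; anySubset?; ∈⊤; ∣⊤∣≡n; ∣p∣≤n)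
open import Data.Integer as ℤ using (ℤ; +_; +≤+; +<+)
import Data.Integer.Properties as ℤ
import Data.Integer.Solver as ℤ-Solver
open import Data.List as List using (List; []; _∷_)
import Data.List.Properties as List
open import Data.List.Membership.Propositional using () renaming (_∈_ to _∈ₗ_)
import Data.List.Membership.Propositional.Properties as ∈ₗ
open import Data.List.Relation.Unary.Any using (here)
import Data.List.Relation.Unary.Unique.DecPropositional.Properties as UniqueDec
import Data.List.Relation.Unary.Unique.Propositional.Properties as Unique
open import Data.Nat as ℕ using (zero; suc)
import Data.Nat.Properties as ℕ
open import Data.Nat.Coprimality as Coprime using (Coprime; 1-coprimeTo)
open import Data.Product using (_,_; proj₁; proj₂)
open import Data.Product.Function.NonDependent.Propositional using (_×-⇔_)
open import Data.Rational as ℚ using (ℚ; mkℚ; 0ℚ; 1ℚ)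
import Data.Rational.Properties as ℚ
import Data.Rational.Solver as ℚ-Solver
open import Data.Vec using (Vec; []; _∷_; lookup; map; here; there)
import Data.Vec.Properties as Vec
open import Function using (_∘_)
open import Function.Bundles using (_⇔_; mk⇔; Equivalence; _↔_; mk↔ₛ′; Inverse; Injection)
open import Function.Properties.Inverse using (↔⇒↣)
open import Function.Construct.Composition using (_⇔-∘_)
open import Function.Construct.Symmetry using (⇔-sym)
open import Relation.Binary.PropositionalEquality
open import Relation.Nullary using (Dec; yes; no)
import Relation.Nullary.Decidable as Dec
open import Relation.Nullary.Decidable using (map′; _×-dec_; _→-dec_; ¬?; decidable-stable)

coprime-1 : ∀ z → Coprime ℤ.∣ z ∣ 1
coprime-1 z = Coprime.sym (1-coprimeTo ℤ.∣ z ∣)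

-- z / 1 is normalised through a gcd, so it does not compute for a variable z.
ℤtoℚ≡mkℚ : ∀ z → ℤtoℚ z ≡ mkℚ z 0 (coprime-1 z)
ℤtoℚ≡mkℚ z = ℚ.↥p/↧p≡p (mkℚ z 0 (coprime-1 z))

ℤtoℚ-+ : ∀ a b → ℤtoℚ (a ℤ.+ b) ≡ ℤtoℚ a ℚ.+ ℤtoℚ b
ℤtoℚ-+ a b rewrite ℤtoℚ≡mkℚ a | ℤtoℚ≡mkℚ b | ℤ.*-identityʳ a | ℤ.*-identityʳ b = refl

ℤtoℚ-mono-≤ : ∀ {a b} → a ℤ.≤ b → ℤtoℚ a ℚ.≤ ℤtoℚ b
ℤtoℚ-mono-≤ {a} {b} a≤b rewrite ℤtoℚ≡mkℚ a | ℤtoℚ≡mkℚ b =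
  ℚ.*≤* (subst₂ ℤ._≤_ (sym (ℤ.*-identityʳ a)) (sym (ℤ.*-identityʳ b)) a≤b)

ℤtoℚ-cancel-≤ : ∀ {a b} → ℤtoℚ a ℚ.≤ ℤtoℚ b → a ℤ.≤ b
ℤtoℚ-cancel-≤ {a} {b} a≤b rewrite ℤtoℚ≡mkℚ a | ℤtoℚ≡mkℚ b with a≤b
... | ℚ.*≤* a*1≤b*1 = subst₂ ℤ._≤_ (ℤ.*-identityʳ a) (ℤ.*-identityʳ b) a*1≤b*1

ℤtoℚ-cancel-< : ∀ {a b} → ℤtoℚ a ℚ.< ℤtoℚ b → a ℤ.< b
ℤtoℚ-cancel-< {a} {b} a<b rewrite ℤtoℚ≡mkℚ a | ℤtoℚ≡mkℚ b with a<b
... | ℚ.*<* a*1<b*1 = subst₂ ℤ._<_ (ℤ.*-identityʳ a) (ℤ.*-identityʳ b) a*1<b*1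

ℤtoℚ-injective : ∀ {a b} → ℤtoℚ a ≡ ℤtoℚ b → a ≡ b
ℤtoℚ-injective {a} {b} eq =
  ℤ.≤-antisym (ℤtoℚ-cancel-≤ (ℚ.≤-reflexive eq)) (ℤtoℚ-cancel-≤ (ℚ.≤-reflexive (sym eq)))

module _ where
  open ℚ-Solver.+-*-Solver

  0≤q-p⇒p≤q : ∀ {p q} → 0ℚ ℚ.≤ q ℚ.- p → p ℚ.≤ q
  0≤q-p⇒p≤q {p} {q} 0≤q-p =
    subst₂ ℚ._≤_ (ℚ.+-identityˡ p) (solve 2 (λ p q → (q :- p) :+ p := q) refl p q) (ℚ.+-monoˡ-≤ p 0≤q-p)

  p≤q⇒0≤q-p : ∀ {p q} → p ℚ.≤ q → 0ℚ ℚ.≤ q ℚ.- p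
  p≤q⇒0≤q-p {p} {q} p≤q = subst (ℚ._≤ q ℚ.- p) (ℚ.+-inverseʳ p) (ℚ.+-monoˡ-≤ (ℚ.- p) p≤q)

  ∣p+q-p∣≡∣q∣ : ∀ p q → ℚ.∣ (p ℚ.+ q) ℚ.- p ∣ ≡ ℚ.∣ q ∣
  ∣p+q-p∣≡∣q∣ p q = cong ℚ.∣_∣ (solve 2 (λ p q → (p :+ q) :- p := q) refl p q)

  p≤∣p∣ : ∀ p → p ℚ.≤ ℚ.∣ p ∣
  p≤∣p∣ (mkℚ (+ _) _ _)      = ℚ.≤-refl
  p≤∣p∣ p@(mkℚ ℤ.-[1+ _ ] _ _) = ℚ.<⇒≤ (ℚ.<-≤-trans (ℚ.negative⁻¹ p) (ℚ.0≤∣p∣ p))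

  -p≤∣p∣ : ∀ p → ℚ.- p ℚ.≤ ℚ.∣ p ∣
  -p≤∣p∣ p = subst (ℚ.- p ℚ.≤_) (ℚ.∣-p∣≡∣p∣ p) (p≤∣p∣ (ℚ.- p))

  ∣p-q∣≤ε⇒p≤q+ε : ∀ {p q ε} → ℚ.∣ p ℚ.- q ∣ ℚ.≤ ε → p ℚ.≤ q ℚ.+ ε
  ∣p-q∣≤ε⇒p≤q+ε {p} {q} {ε} ∣p-q∣≤ε =
    subst (ℚ._≤ q ℚ.+ ε) (solve 2 (λ p q → q :+ (p :- q) := p) refl p q)
      (ℚ.+-monoʳ-≤ q (ℚ.≤-trans (p≤∣p∣ (p ℚ.- q)) ∣p-q∣≤ε))

  ∣p-q∣≤ε⇒q-ε≤p : ∀ {p q ε} → ℚ.∣ p ℚ.- q ∣ ℚ.≤ ε → q ℚ.- ε ℚ.≤ p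
  ∣p-q∣≤ε⇒q-ε≤p {p} {q} {ε} ∣p-q∣≤ε =
    subst (q ℚ.- ε ℚ.≤_) (solve 2 (λ p q → q :+ (:- (:- (p :- q))) := p) refl p q)
      (ℚ.+-monoʳ-≤ q (ℚ.neg-antimono-≤ (ℚ.≤-trans (-p≤∣p∣ (p ℚ.- q)) ∣p-q∣≤ε)))

1/[1+_] : ℕ → ℚ
1/[1+ n ] = mkℚ (+ 1) n (1-coprimeTo (suc n))

m≤1+n⇒m*1/[1+n]≤1 : ∀ {m n} → m ℕ.≤ suc n → ℕtoℚ m ℚ.* 1/[1+ n ] ℚ.≤ 1ℚ
m≤1+n⇒m*1/[1+n]≤1 {m} {n} m≤1+n =
  subst (ℕtoℚ m ℚ.* 1/[1+ n ] ℚ.≤_) [1+n]*1/[1+n]≡1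
    (ℚ.*-monoʳ-≤-nonNeg 1/[1+ n ] (ℤtoℚ-mono-≤ (+≤+ m≤1+n)))
  where
  [1+n]*1/[1+n]≡1 : ℕtoℚ (suc n) ℚ.* 1/[1+ n ] ≡ 1ℚ
  [1+n]*1/[1+n]≡1 rewrite ℤtoℚ≡mkℚ (+ suc n) = ℚ.*-inverseʳ (mkℚ (+ suc n) 0 (coprime-1 (+ suc n)))

+-cancelˡ-≤ : ∀ i {j k} → i ℤ.+ j ℤ.≤ i ℤ.+ k → j ℤ.≤ k
+-cancelˡ-≤ i {j} {k} i+j≤i+k =
  decidable-stable (j ℤ.≤? k) (λ j≰k → ℤ.<⇒≱ (ℤ.+-monoʳ-< i (ℤ.≰⇒> j≰k)) i+j≤i+k)

+-cancelˡ-< : ∀ i {j k} → i ℤ.+ j ℤ.< i ℤ.+ k → j ℤ.< k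
+-cancelˡ-< i {j} {k} i+j<i+k =
  decidable-stable (j ℤ.<? k) (λ j≮k → ℤ.≤⇒≯ (ℤ.+-monoʳ-≤ i (ℤ.≮⇒≥ j≮k)) i+j<i+k)

sumℤ : ∀ {n} → Subset n → Vec ℤ n → ℤ
sumℤ []          []       = + 0
sumℤ (true  ∷ I) (x ∷ xs) = x ℤ.+ sumℤ I xs
sumℤ (false ∷ I) (x ∷ xs) = sumℤ I xs

translate : ∀ {n} → ℚ → Vec ℚ n → Vec ℚ n
translate c = map (ℚ._+ c)

lookup-embed : ∀ {n} (x : Vec ℤ n) e → lookup (embed x) e ≡ ℤtoℚ (lookup x e)
lookup-embed x e = Vec.lookup-map e ℤtoℚ x

lookup-translate : ∀ {n} c (v : Vec ℚ n) e → lookup (translate c v) e ≡ lookup v e ℚ.+ c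
lookup-translate c v e = Vec.lookup-map e (ℚ._+ c) v

∣lookup-translate-lookup∣≡∣c∣ : ∀ {n} c (v : Vec ℚ n) e →
                                ℚ.∣ lookup (translate c v) e ℚ.- lookup v e ∣ ≡ ℚ.∣ c ∣
∣lookup-translate-lookup∣≡∣c∣ c v e =
  trans (cong (λ t → ℚ.∣ t ℚ.- lookup v e ∣) (lookup-translate c v e)) (∣p+q-p∣≡∣q∣ (lookup v e) c)

sumOver-embed : ∀ {n} (I : Subset n) x → sumOver I (embed x) ≡ ℤtoℚ (sumℤ I x)
sumOver-embed []          []       = refl
sumOver-embed (true  ∷ I) (x ∷ xs) =
  trans (cong (ℤtoℚ x ℚ.+_) (sumOver-embed I xs)) (sym (ℤtoℚ-+ x (sumℤ I xs)))
sumOver-embed (false ∷ I) (x ∷ xs) = sumOver-embed I xs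

sumOver-mono-≤ : ∀ {n} (I : Subset n) {v w : Vec ℚ n} →
                 (∀ e → lookup v e ℚ.≤ lookup w e) → sumOver I v ℚ.≤ sumOver I w
sumOver-mono-≤ []          {[]}    {[]}    v≤w = ℚ.≤-refl
sumOver-mono-≤ (true  ∷ I) {_ ∷ _} {_ ∷ _} v≤w = ℚ.+-mono-≤ (v≤w fzero) (sumOver-mono-≤ I (v≤w ∘ fsuc))
sumOver-mono-≤ (false ∷ I) {_ ∷ _} {_ ∷ _} v≤w = sumOver-mono-≤ I (v≤w ∘ fsuc)

sumOver-mono-< : ∀ {n} (I : Subset n) {v w : Vec ℚ n} → Nonempty I →
                 (∀ e → lookup v e ℚ.< lookup w e) → sumOver I v ℚ.< sumOver I w
sumOver-mono-< (true  ∷ I) {_ ∷ _} {_ ∷ _} _ v<w =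
  ℚ.+-mono-<-≤ (v<w fzero) (sumOver-mono-≤ I (ℚ.<⇒≤ ∘ v<w ∘ fsuc))
sumOver-mono-< (false ∷ I) {_ ∷ _} {_ ∷ _} (fsuc e , there e∈I) v<w =
  sumOver-mono-< I (e , e∈I) (v<w ∘ fsuc)

sumOver-empty : ∀ {n} (I : Subset n) (v : Vec ℚ n) → ¬ Nonempty I → sumOver I v ≡ 0ℚ
sumOver-empty []          []      _     = refl
sumOver-empty (true  ∷ I) (_ ∷ _) empty = ⊥-elim (empty (fzero , here))
sumOver-empty (false ∷ I) (_ ∷ v) empty = sumOver-empty I v (λ (e , e∈I) → empty (fsuc e , there e∈I))

sumOver-empty-≤ : ∀ {n} (I : Subset n) (v : Vec ℚ n) m → ¬ Nonempty I → sumOver I v ℚ.≤ ℕtoℚ m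
sumOver-empty-≤ I v m empty =
  subst (ℚ._≤ ℕtoℚ m) (sym (sumOver-empty I v empty)) (ℤtoℚ-mono-≤ {+ 0} {+ m} (+≤+ ℕ.z≤n))

sumOver-translate : ∀ {n} (I : Subset n) (v : Vec ℚ n) c →
                    sumOver I (translate c v) ≡ ℕtoℚ ∣ I ∣ ℚ.* c ℚ.+ sumOver I v
sumOver-translate []          []      c = sym (trans (ℚ.+-identityʳ _) (ℚ.*-zeroˡ c))
sumOver-translate (true  ∷ I) (a ∷ v) c = begin
  (a ℚ.+ c) ℚ.+ sumOver I (translate c v)  ≡⟨ cong ((a ℚ.+ c) ℚ.+_) (sumOver-translate I v c) ⟩
  (a ℚ.+ c) ℚ.+ (m ℚ.* c ℚ.+ s)            ≡⟨ solve 4 (λ a c s m → (a :+ c) :+ (m :* c :+ s) := (con 1ℚ :+ m) :* c :+ (a :+ s)) refl a c s m ⟩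
  (1ℚ ℚ.+ m) ℚ.* c ℚ.+ (a ℚ.+ s)           ≡⟨ cong (λ t → t ℚ.* c ℚ.+ (a ℚ.+ s)) (sym (ℤtoℚ-+ (+ 1) (+ ∣ I ∣))) ⟩
  ℕtoℚ (suc ∣ I ∣) ℚ.* c ℚ.+ (a ℚ.+ s)     ∎
  where
  open ≡-Reasoning
  open ℚ-Solver.+-*-Solver
  s = sumOver I v
  m = ℕtoℚ ∣ I ∣
sumOver-translate (false ∷ I) (a ∷ v) c = sumOver-translate I v c

sumℤ-map-suc : ∀ {n} (I : Subset n) (z : Vec ℤ n) → sumℤ I (map ℤ.suc z) ≡ + ∣ I ∣ ℤ.+ sumℤ I z
sumℤ-map-suc []          []      = refl
sumℤ-map-suc (true  ∷ I) (a ∷ z) =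
  trans (cong (λ t → ℤ.suc a ℤ.+ t) (sumℤ-map-suc I z))
    (solve 3 (λ a s m → (con (+ 1) :+ a) :+ (m :+ s) := (con (+ 1) :+ m) :+ (a :+ s)) refl a (sumℤ I z) (+ ∣ I ∣))
  where open ℤ-Solver.+-*-Solver
sumℤ-map-suc (false ∷ I) (a ∷ z) = sumℤ-map-suc I z

sumℤ-nonneg : ∀ {n} (I : Subset n) {z : Vec ℤ n} → (∀ e → + 0 ℤ.≤ lookup z e) → + 0 ℤ.≤ sumℤ I z
sumℤ-nonneg []          {[]}    0≤z = +≤+ ℕ.z≤n
sumℤ-nonneg (true  ∷ I) {_ ∷ _} 0≤z = ℤ.+-mono-≤ (0≤z fzero) (sumℤ-nonneg I (0≤z ∘ fsuc))
sumℤ-nonneg (false ∷ I) {_ ∷ _} 0≤z = sumℤ-nonneg I (0≤z ∘ fsuc)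

lookup≤sumℤ : ∀ {n} (I : Subset n) {z : Vec ℤ n} {e} → e ∈ I →
              (∀ e → + 0 ℤ.≤ lookup z e) → lookup z e ℤ.≤ sumℤ I z
lookup≤sumℤ (true  ∷ I) {a ∷ z} here        0≤z = ℤ.i≤i+j a (sumℤ I z) {{ℤ.nonNegative (sumℤ-nonneg I (0≤z ∘ fsuc))}}
lookup≤sumℤ (true  ∷ I) {a ∷ z} (there e∈I) 0≤z =
  ℤ.≤-trans (lookup≤sumℤ I e∈I (0≤z ∘ fsuc)) (ℤ.i≤j⇒i≤k+j a {{ℤ.nonNegative (0≤z fzero)}} ℤ.≤-refl)
lookup≤sumℤ (false ∷ I) {a ∷ z} (there e∈I) 0≤z = lookup≤sumℤ I e∈I (0≤z ∘ fsuc)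

vectorsOver : ∀ {A : Set} m → List A → List (Vec A m)
vectorsOver zero    R = [] ∷ []
vectorsOver (suc m) R = List.cartesianProductWith _∷_ R (vectorsOver m R)

∈-vectorsOver : ∀ {A : Set} {m} {R : List A} (v : Vec A m) → (∀ e → lookup v e ∈ₗ R) → v ∈ₗ vectorsOver m R
∈-vectorsOver []      v⊆R = here refl
∈-vectorsOver (a ∷ v) v⊆R = ∈ₗ.∈-cartesianProductWith⁺ _∷_ (v⊆R fzero) (∈-vectorsOver v (v⊆R ∘ fsuc))

enumerates-filter : ∀ {m} {P : Vec ℤ m → Set} (P? : ∀ x → Dec (P x)) (B : List (Vec ℤ m)) →
                    (∀ x → P x → x ∈ₗ B) → Enumerates P (List.deduplicate (Vec.≡-dec ℤ._≟_) (List.filter P? B))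
enumerates-filter P? B P⊆B =
  UniqueDec.deduplicate-! _≟_ (List.filter P? B) ,
  λ x → mk⇔ (proj₂ ∘ ∈ₗ.∈-filter⁻ P? {xs = B} ∘ ∈ₗ.∈-deduplicate⁻ _≟_ (List.filter P? B))
            (λ Px → ∈ₗ.∈-deduplicate⁺ _≟_ (∈ₗ.∈-filter⁺ P? (P⊆B x Px) Px))
  where _≟_ = Vec.≡-dec ℤ._≟_

enumerates-map : ∀ {m} {P Q : Vec ℤ m → Set} {L} (f : Vec ℤ m ↔ Vec ℤ m) →
                 (∀ x → P x ⇔ Q (Inverse.to f x)) → Enumerates P L → Enumerates Q (List.map (Inverse.to f) L)
enumerates-map {P = P} {Q} {L} f P⇔Q∘f (unique , L⇔P) =
  Unique.map⁺ (Injection.injective (↔⇒↣ f)) unique , λ y → mk⇔ (⇒ y) (⇐ y)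
  where
  open Inverse f
  ⇒ : ∀ y → y ∈ₗ List.map to L → Q y
  ⇒ y y∈fL with x , x∈L , refl ← ∈ₗ.∈-map⁻ to y∈fL = Equivalence.to (P⇔Q∘f x) (Equivalence.to (L⇔P x) x∈L)
  ⇐ : ∀ y → Q y → y ∈ₗ List.map to L
  ⇐ y Qy = subst (_∈ₗ List.map to L) (strictlyInverseˡ y)
    (∈ₗ.∈-map⁺ to (Equivalence.from (L⇔P (from y))
      (Equivalence.from (P⇔Q∘f (from y)) (subst Q (sym (strictlyInverseˡ y)) Qy))))

∀-cong-⇔ : ∀ {A : Set} {B C : A → Set} → (∀ a → B a ⇔ C a) → (∀ a → B a) ⇔ (∀ a → C a)
∀-cong-⇔ B⇔C = mk⇔ (λ f a → Equivalence.to (B⇔C a) (f a)) (λ g a → Equivalence.from (B⇔C a) (g a))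

sameCount-↔ : ∀ {m} {P Q : Vec ℤ m → Set} {L} (f : Vec ℤ m ↔ Vec ℤ m) →
              (∀ x → P x ⇔ Q (Inverse.to f x)) → Enumerates P L → SameCount Q P
sameCount-↔ {L = L} f P⇔Q∘f enumP =
  List.map (Inverse.to f) L , L , enumerates-map f P⇔Q∘f enumP , enumP , List.length-map (Inverse.to f) L

allSubset? : ∀ {n} {P : Subset n → Set} → (∀ I → Dec (P I)) → Dec (∀ I → P I)
allSubset? P? =
  map′ (λ ∄¬P I → decidable-stable (P? I) (λ ¬PI → ∄¬P (I , ¬PI))) (λ ∀P (I , ¬PI) → ¬PI (∀P I))
       (¬? (anySubset? (¬? ∘ P?)))

map-suc-↔ : ∀ {m} → Vec ℤ m ↔ Vec ℤ m
map-suc-↔ = mk↔ₛ′ (map ℤ.suc) (map ℤ.pred) (inverse ℤ.suc-pred) (inverse ℤ.pred-suc)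
  where
  inverse : ∀ {f g : ℤ → ℤ} → (∀ a → f (g a) ≡ a) → ∀ {m} (z : Vec ℤ m) → map f (map g z) ≡ z
  inverse f∘g z = trans (sym (Vec.map-∘ _ _ z)) (trans (Vec.map-cong f∘g z) (Vec.map-id z))

module _ {n} (τ : Preorder n) where

  StrictlyFeasible : ℤ → ℕ → Vec ℤ n → Set
  StrictlyFeasible lo k x =
    (∀ e → lo ℤ.≤ lookup x e) ×
    (∀ I → IsOrderIdeal τ I → Nonempty I → sumℤ I x ℤ.< + (k ℕ.* ∣ I ∣))

  isOrderIdeal? : ∀ I → Dec (IsOrderIdeal τ I)
  isOrderIdeal? I = all? λ a → all? λ b → (b ∈? I) →-dec (Preorder.dec τ a b →-dec (a ∈? I))

  strictlyFeasible? : ∀ lo k x → Dec (StrictlyFeasible lo k x)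
  strictlyFeasible? lo k x =
    all? (λ e → lo ℤ.≤? lookup x e) ×-dec
    allSubset? (λ I → isOrderIdeal? I →-dec (nonempty? I →-dec (sumℤ I x ℤ.<? + (k ℕ.* ∣ I ∣))))

  interior⇒strictlyFeasible : ∀ {k} x → InInteriorDilatedQ τ k x → StrictlyFeasible (+ 1) k x
  interior⇒strictlyFeasible {k} x (ε , 0<ε , ball⊆kQ) = positive , belowIdeals
    where
    translate-inBall : ∀ c → ℚ.∣ c ∣ ≡ ε → InDilatedQ τ k (translate c (embed x))
    translate-inBall c ∣c∣≡ε = ball⊆kQ (translate c (embed x)) λ e →
      ℚ.≤-reflexive (trans (∣lookup-translate-lookup∣≡∣c∣ c (embed x) e) ∣c∣≡ε)
    ∣ε∣≡ε : ℚ.∣ ε ∣ ≡ ε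
    ∣ε∣≡ε = ℚ.0≤p⇒∣p∣≡p (ℚ.<⇒≤ 0<ε)
    positive : ∀ e → + 1 ℤ.≤ lookup x e
    positive e = ℤ.i<j⇒suc[i]≤j (ℤtoℚ-cancel-< {+ 0} (ℚ.<-≤-trans 0<ε ε≤xₑ))
      where
      ε≤xₑ : ε ℚ.≤ ℤtoℚ (lookup x e)
      ε≤xₑ = 0≤q-p⇒p≤q (subst (0ℚ ℚ.≤_)
        (trans (lookup-translate (ℚ.- ε) (embed x) e) (cong (ℚ._- ε) (lookup-embed x e)))
        (proj₁ (translate-inBall (ℚ.- ε) (trans (ℚ.∣-p∣≡∣p∣ ε) ∣ε∣≡ε)) e))
    belowIdeals : ∀ I → IsOrderIdeal τ I → Nonempty I → sumℤ I x ℤ.< + (k ℕ.* ∣ I ∣)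
    belowIdeals I ideal nonempty = ℤtoℚ-cancel-< (subst (ℚ._< ℕtoℚ (k ℕ.* ∣ I ∣)) (sumOver-embed I x)
      (ℚ.<-≤-trans (sumOver-mono-< I nonempty x<x+ε) (proj₂ (translate-inBall ε ∣ε∣≡ε) I ideal)))
      where
      x<x+ε : ∀ e → lookup (embed x) e ℚ.< lookup (translate ε (embed x)) e
      x<x+ε e = subst₂ ℚ._<_ (ℚ.+-identityʳ _) (sym (lookup-translate ε (embed x) e))
        (ℚ.+-monoʳ-< (lookup (embed x) e) 0<ε)

  strictlyFeasible⇒interior : ∀ {k} x → StrictlyFeasible (+ 1) k x → InInteriorDilatedQ τ k x
  strictlyFeasible⇒interior {k} x (positive , sum<k∣I∣) =
    ε , ℚ.positive⁻¹ ε , λ y near → nonneg y near , belowIdeals y near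
    where
    -- |I|·ε ≤ 1 for every I, so the integer slack Σ_I x + 1 ≤ k|I| absorbs the box.
    ε : ℚ
    ε = 1/[1+ n ]
    Near : Vec ℚ n → Set
    Near y = ∀ e → ℚ.∣ lookup y e ℚ.- lookup (embed x) e ∣ ℚ.≤ ε
    nonneg : ∀ y → Near y → ∀ e → 0ℚ ℚ.≤ lookup y e
    nonneg y near e = ℚ.≤-trans (p≤q⇒0≤q-p ε≤xₑ) (subst (λ t → t ℚ.- ε ℚ.≤ lookup y e) (lookup-embed x e)
      (∣p-q∣≤ε⇒q-ε≤p (near e)))
      where
      ε≤xₑ : ε ℚ.≤ ℤtoℚ (lookup x e)
      ε≤xₑ = ℚ.≤-trans (subst (ℚ._≤ 1ℚ) (ℚ.*-identityˡ ε) (m≤1+n⇒m*1/[1+n]≤1 {1} {n} (ℕ.s≤s ℕ.z≤n)))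
                       (ℤtoℚ-mono-≤ (positive e))
    belowIdeals : ∀ y → Near y → ∀ I → IsOrderIdeal τ I → sumOver I y ℚ.≤ ℕtoℚ (k ℕ.* ∣ I ∣)
    belowIdeals y near I ideal with nonempty? I
    ... | no empty = sumOver-empty-≤ I y (k ℕ.* ∣ I ∣) empty
    ... | yes nonempty = begin
      sumOver I y                               ≤⟨ sumOver-mono-≤ I y≤x+ε ⟩
      sumOver I (translate ε (embed x))         ≡⟨ sumOver-translate I (embed x) ε ⟩
      ℕtoℚ ∣ I ∣ ℚ.* ε ℚ.+ sumOver I (embed x)   ≤⟨ ℚ.+-monoˡ-≤ (sumOver I (embed x)) ∣I∣ε≤1 ⟩
      1ℚ ℚ.+ sumOver I (embed x)                ≡⟨ cong (1ℚ ℚ.+_) (sumOver-embed I x) ⟩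
      ℤtoℚ (+ 1) ℚ.+ ℤtoℚ (sumℤ I x)            ≡⟨ sym (ℤtoℚ-+ (+ 1) (sumℤ I x)) ⟩
      ℤtoℚ (ℤ.suc (sumℤ I x))                   ≤⟨ ℤtoℚ-mono-≤ (ℤ.i<j⇒suc[i]≤j (sum<k∣I∣ I ideal nonempty)) ⟩
      ℕtoℚ (k ℕ.* ∣ I ∣)                        ∎
      where
      ∣I∣ε≤1 : ℕtoℚ ∣ I ∣ ℚ.* ε ℚ.≤ 1ℚ
      ∣I∣ε≤1 = m≤1+n⇒m*1/[1+n]≤1 (ℕ.m≤n⇒m≤1+n (∣p∣≤n I))
      open ℚ.≤-Reasoning
      y≤x+ε : ∀ e → lookup y e ℚ.≤ lookup (translate ε (embed x)) e
      y≤x+ε e = subst (lookup y e ℚ.≤_) (sym (lookup-translate ε (embed x) e)) (∣p-q∣≤ε⇒p≤q+ε (near e))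

  interior⇔strictlyFeasible : ∀ k x → InInteriorDilatedQ τ k x ⇔ StrictlyFeasible (+ 1) k x
  interior⇔strictlyFeasible k x = mk⇔ (interior⇒strictlyFeasible {k} x) (strictlyFeasible⇒interior {k} x)

  BelowUpperBoundary : Vec ℤ n → Set
  BelowUpperBoundary x = InDilatedQ τ 1 (embed x) × ¬ InUpperBoundary τ (embed x)

  belowUpperBoundary⇒strictlyFeasible : ∀ x → BelowUpperBoundary x → StrictlyFeasible (+ 0) 1 x
  belowUpperBoundary⇒strictlyFeasible x (inQ@(nonneg , belowIdeals) , notUpper) = nonnegℤ , strict
    where
    nonnegℤ : ∀ e → + 0 ℤ.≤ lookup x e
    nonnegℤ e = ℤtoℚ-cancel-≤ {+ 0} (subst (0ℚ ℚ.≤_) (lookup-embed x e) (nonneg e))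
    strict : ∀ I → IsOrderIdeal τ I → Nonempty I → sumℤ I x ℤ.< + (1 ℕ.* ∣ I ∣)
    strict I ideal nonempty = ℤ.≤∧≢⇒< sum≤ sum≢
      where
      sum≤ : sumℤ I x ℤ.≤ + (1 ℕ.* ∣ I ∣)
      sum≤ = ℤtoℚ-cancel-≤ (subst (ℚ._≤ ℕtoℚ (1 ℕ.* ∣ I ∣)) (sumOver-embed I x) (belowIdeals I ideal))
      sum≢ : sumℤ I x ≢ + (1 ℕ.* ∣ I ∣)
      sum≢ sum≡ = notUpper (inQ , I , ideal , nonempty ,
        trans (sumOver-embed I x) (cong ℤtoℚ (trans sum≡ (cong +_ (ℕ.*-identityˡ ∣ I ∣)))))

  strictlyFeasible⇒belowUpperBoundary : ∀ x → StrictlyFeasible (+ 0) 1 x → BelowUpperBoundary x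
  strictlyFeasible⇒belowUpperBoundary x (nonneg , strict) = (nonnegℚ , belowIdeals) , notUpper
    where
    nonnegℚ : ∀ e → 0ℚ ℚ.≤ lookup (embed x) e
    nonnegℚ e = subst (0ℚ ℚ.≤_) (sym (lookup-embed x e)) (ℤtoℚ-mono-≤ (nonneg e))
    belowIdeals : ∀ I → IsOrderIdeal τ I → sumOver I (embed x) ℚ.≤ ℕtoℚ (1 ℕ.* ∣ I ∣)
    belowIdeals I ideal with nonempty? I
    ... | no empty = sumOver-empty-≤ I (embed x) (1 ℕ.* ∣ I ∣) empty
    ... | yes nonempty = subst (ℚ._≤ ℕtoℚ (1 ℕ.* ∣ I ∣)) (sym (sumOver-embed I x))
                           (ℤtoℚ-mono-≤ (ℤ.<⇒≤ (strict I ideal nonempty)))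
    notUpper : ¬ InUpperBoundary τ (embed x)
    notUpper (_ , I , ideal , nonempty , sum≡) = ℤ.<⇒≢ (strict I ideal nonempty)
      (ℤtoℚ-injective {b = + (1 ℕ.* ∣ I ∣)}
        (trans (sym (sumOver-embed I x)) (trans sum≡ (cong ℕtoℚ (sym (ℕ.*-identityˡ ∣ I ∣))))))

  belowUpperBoundary⇔strictlyFeasible : ∀ x → BelowUpperBoundary x ⇔ StrictlyFeasible (+ 0) 1 x
  belowUpperBoundary⇔strictlyFeasible x =
    mk⇔ (belowUpperBoundary⇒strictlyFeasible x) (strictlyFeasible⇒belowUpperBoundary x)

  strictlyFeasible-map-suc : ∀ lo k z → StrictlyFeasible lo k z ⇔ StrictlyFeasible (ℤ.suc lo) (suc k) (map ℤ.suc z)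
  strictlyFeasible-map-suc lo k z =
    ∀-cong-⇔ coordinate ×-⇔ ∀-cong-⇔ λ I → ∀-cong-⇔ λ _ → ∀-cong-⇔ λ _ → idealSum I
    where
    coordinate : ∀ e → (lo ℤ.≤ lookup z e) ⇔ (ℤ.suc lo ℤ.≤ lookup (map ℤ.suc z) e)
    coordinate e rewrite Vec.lookup-map e ℤ.suc z = mk⇔ (ℤ.+-monoʳ-≤ (+ 1)) (+-cancelˡ-≤ (+ 1))
    idealSum : ∀ I → (sumℤ I z ℤ.< + (k ℕ.* ∣ I ∣)) ⇔ (sumℤ I (map ℤ.suc z) ℤ.< + (suc k ℕ.* ∣ I ∣))
    idealSum I rewrite sumℤ-map-suc I z | ℤ.pos-+ ∣ I ∣ (k ℕ.* ∣ I ∣) =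
      mk⇔ (ℤ.+-monoʳ-< (+ ∣ I ∣)) (+-cancelˡ-< (+ ∣ I ∣))

  strictlyFeasible-bounded : ∀ z → StrictlyFeasible (+ 0) 1 z → ∀ e → lookup z e ∈ₗ List.map +_ (List.upTo n)
  strictlyFeasible-bounded z (nonneg , below) e =
    ∈range (nonneg e) (ℤ.≤-<-trans (lookup≤sumℤ ⊤ ∈⊤ nonneg) sum<n)
    where
    sum<n : sumℤ ⊤ z ℤ.< + n
    sum<n = subst (λ m → sumℤ ⊤ z ℤ.< + m) (trans (ℕ.*-identityˡ ∣ ⊤ {n} ∣) (∣⊤∣≡n n))
                  (below ⊤ (λ _ _ _ _ → ∈⊤) (e , ∈⊤))
    ∈range : ∀ {i} → + 0 ℤ.≤ i → i ℤ.< + n → i ∈ₗ List.map +_ (List.upTo n)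
    ∈range (+≤+ _) (+<+ i<n) = ∈ₗ.∈-map⁺ +_ (∈ₗ.∈-upTo⁺ i<n)

proposition3p5 : (n : ℕ) (τ : Preorder n) →
    SameCount (λ x → InInteriorDilatedQ τ 2 x)
              (λ x → InDilatedQ τ 1 (embed x) × ¬ InUpperBoundary τ (embed x))
proposition3p5 n τ =
  sameCount-↔ map-suc-↔ below⇔interior (enumerates-filter below? box inBox)
  where
  below⇔feasible : ∀ x → BelowUpperBoundary τ x ⇔ StrictlyFeasible τ (+ 0) 1 x
  below⇔feasible = belowUpperBoundary⇔strictlyFeasible τ
  below⇔interior : ∀ x → BelowUpperBoundary τ x ⇔ InInteriorDilatedQ τ 2 (map ℤ.suc x)
  below⇔interior x = ⇔-sym (interior⇔strictlyFeasible τ 2 (map ℤ.suc x))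
                 ⇔-∘ (strictlyFeasible-map-suc τ (+ 0) 1 x ⇔-∘ below⇔feasible x)
  below? : ∀ x → Dec (BelowUpperBoundary τ x)
  below? x = Dec.map (⇔-sym (below⇔feasible x)) (strictlyFeasible? τ (+ 0) 1 x)
  box : List (Vec ℤ n)
  box = vectorsOver n (List.map +_ (List.upTo n))
  inBox : ∀ x → BelowUpperBoundary τ x → x ∈ₗ box
  inBox x below = ∈-vectorsOver x (strictlyFeasible-bounded τ x (Equivalence.to (below⇔feasible x) below))
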